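{- Let $p$ and $q$ be two distinct primes and let $G$ be a cyclic group of order $p^2q$. Then \begin{align*} M_1(\mathcal{B}(G))={}&p^8q^4+2p^4q^4+4p^6q^2-2p^6q^4+2p^8+4p^4-2p^8q^2-3p^4q^2-4p^6-2p^2q^4\\&+4p^2q^2+2q^4-4p^2-4q^2+4,\\ M_2(\mathcal{B}(G))={}&p^8q^4+2p^4q^4+4p^6q^2-2p^6q^4+2p^8+4p^4-2p^8q^2-4p^4q^2-4p^6-2p^2q^4\\&+4p^2q^2+2q^4-4p^2-4q^2+4, \end{align*} and \[ \frac{M_{2}(\mathcal{B}(G))}{\vert e(\mathcal{B}(G))\vert} > \frac{M_{1}(\mathcal{B}(G))}{\vert V(\mathcal{B}(G)) \vert}. \]
   Context: For a finite group $G$, let $L(G)$ be the set of all subgroups of $G$. The SGB-graph $\mathcal{B}(G)$ is the bipartite graph with vertex set $V(\mathcal{B}(G))=(G\times G)\sqcup L(G)$, in which $(a,b)\in G\times G$ is adjacent to $H\in L(G)$ if and only if $H=\langle a,b\rangle$; there are no other edges. For a simple graph $\mathcal{G}$ with vertex set $V(\mathcal{G})$ and edge set $e(\mathcal{G})$, the first and second Zagreb indices are $M_1(\mathcal{G})=\sum_{v\in V(\mathcal{G})}\deg(v)^2$ and $M_2(\mathcal{G})=\sum_{uv\in e(\mathcal{G})}\deg(u)\deg(v)$. -}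

module Defs where

open import Data.Nat using (ℕ; zero; suc; _+_; _*_)
open import Data.Fin using (Fin)
open import Data.Fin.Properties using (all?)
open import Data.Fin.Subset using (Subset; _∈_; _⊆_; inside; outside)
open import Data.Fin.Subset.Properties using (_∈?_; _⊆?_)
open import Data.Vec using ([]; _∷_)
open import Data.List using (List; []; _∷_; _++_; map; filter; length; allFin; cartesianProduct; concatMap)
open import Data.Product using (_×_; _,_; ∃; proj₁; proj₂)
open import Relation.Nullary using (Dec; yes; no)
open import Relation.Nullary.Decidable using (_×-dec_; _→-dec_; map′)
open import Relation.Binary.PropositionalEquality using (_≡_)
open import Algebra.Structures using (IsGroup)
open import Function using (_∘_)
open import Data.Nat.ListAction using (sum)

-- A finite group: a group structure (in the sense of the standard
-- library's IsGroup) whose carrier is Fin order.  Every finite group is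
-- isomorphic to one of this form.

record FinGroup : Set where
  field
    order   : ℕ
    _∙_     : Fin order → Fin order → Fin order
    ε       : Fin order
    _⁻¹     : Fin order → Fin order
    isGroup : IsGroup _≡_ _∙_ ε _⁻¹

allSubset? : ∀ {n} {P : Subset n → Set} → (∀ s → Dec (P s)) → Dec (∀ s → P s)
allSubset? {zero} P? = map′ (λ p → λ { [] → p }) (λ f → f []) (P? [])
allSubset? {suc n} P? =
  map′ (λ { (a , b) → λ { (inside ∷ s) → a s ; (outside ∷ s) → b s } })
       (λ f → (λ s → f (inside ∷ s)) , (λ s → f (outside ∷ s)))
       (allSubset? (P? ∘ (inside ∷_)) ×-dec allSubset? (P? ∘ (outside ∷_)))

allSubsets : (n : ℕ) → List (Subset n)
allSubsets zero = [] ∷ []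
allSubsets (suc n) = map (inside ∷_) (allSubsets n) ++ map (outside ∷_) (allSubsets n)

module _ (G : FinGroup) where
  open FinGroup G

  pow : Fin order → ℕ → Fin order
  pow g zero = ε
  pow g (suc k) = g ∙ pow g k

  IsCyclic : Set
  IsCyclic = ∃ λ g → ∀ x → ∃ λ k → x ≡ pow g k

  IsSubgroup : Subset order → Set
  IsSubgroup H = (ε ∈ H)
               × (∀ x y → x ∈ H → y ∈ H → (x ∙ y) ∈ H)
               × (∀ x → x ∈ H → (x ⁻¹) ∈ H)

  isSubgroup? : ∀ H → Dec (IsSubgroup H)
  isSubgroup? H =
    (ε ∈? H)
    ×-dec all? (λ x → all? (λ y → (x ∈? H) →-dec ((y ∈? H) →-dec ((x ∙ y) ∈? H))))
    ×-dec all? (λ x → (x ∈? H) →-dec ((x ⁻¹) ∈? H))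

  Generates : Fin order → Fin order → Subset order → Set
  Generates a b H = IsSubgroup H × a ∈ H × b ∈ H
                  × (∀ K → IsSubgroup K → a ∈ K → b ∈ K → H ⊆ K)

  generates? : ∀ a b H → Dec (Generates a b H)
  generates? a b H =
    isSubgroup? H ×-dec (a ∈? H) ×-dec (b ∈? H)
    ×-dec allSubset? (λ K → isSubgroup? K →-dec ((a ∈? K) →-dec ((b ∈? K) →-dec (H ⊆? K))))

  subgroups : List (Subset order)
  subgroups = filter isSubgroup? (allSubsets order)

  pairs : List (Fin order × Fin order)
  pairs = cartesianProduct (allFin order) (allFin order)

  -- The SGB-graph B(G): vertices G×G ⊔ L(G); (a,b) ~ H iff H = ⟨a,b⟩.

  degPair : Fin order × Fin order → ℕ
  degPair (a , b) = length (filter (generates? a b) subgroups)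

  degSub : Subset order → ℕ
  degSub H = length (filter (λ ab → generates? (proj₁ ab) (proj₂ ab) H) pairs)

  edges : List ((Fin order × Fin order) × Subset order)
  edges = filter (λ e → generates? (proj₁ (proj₁ e)) (proj₂ (proj₁ e)) (proj₂ e))
                 (cartesianProduct pairs subgroups)

  numVertices : ℕ
  numVertices = length pairs + length subgroups

  numEdges : ℕ
  numEdges = length edges

  M₁ : ℕ
  M₁ = sum (map (λ v → degPair v * degPair v) pairs)
     + sum (map (λ H → degSub H * degSub H) subgroups)

  M₂ : ℕ
  M₂ = sum (map (λ e → degPair (proj₁ e) * degSub (proj₂ e)) edges)

{-# OPTIONS --safe #-}
module Submission where

-- In a cyclic group G = ⟨ g ⟩ of order n the subgroups are the S d = { x | d ∣ log x } = ⟨ g ^ d ⟩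
-- for the divisors d of n.  In any finite group each pair (a , b) generates exactly one subgroup, so
-- the pair vertices of B(G) have degree 1: |e(B(G))| = n², M₂ = Σ_H deg(H)² and M₁ = n² + M₂.
-- The pairs generating a subgroup of S d′ are exactly the pairs in S d′ × S d′, so
-- Σ_{d′ ∣ d} deg(S d) = (n / d′)².  For n = p² q this triangular system gives
-- deg(S (p^i q^j)) = J₂(p^(2-i)) J₂(q^(1-j)) with Jordan's totient J₂, whence
-- M₂ = (1 + (p² - 1)² + (p⁴ - p²)²) (1 + (q² - 1)²); the inequality amounts to n⁴ < 6 M₂.

open import Defs
open import Data.Nat.Primality using (Prime)
open import Relation.Binary.PropositionalEquality using (_≡_; _≢_)
import Data.Nat as ℕ

module ListSums where
  open import Algebra.Properties.CommutativeSemigroup using (interchange)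
  open import Data.Bool.Base using (true; false; if_then_else_)
  open import Data.List.Base using (List; []; _∷_; _++_; map; filter; length; cartesianProduct)
  open import Data.List.Membership.Propositional using (_∈_)
  open import Data.List.Properties using (length-map; length-++; map-++; map-∘)
  import Data.List.Relation.Unary.All as All
  open import Data.List.Relation.Unary.Any using (here; there)
  open import Data.List.Relation.Unary.Unique.Propositional using (Unique; _∷_)
  open import Data.Nat.Base using (ℕ; suc; _+_; _*_)
  open import Data.Nat.ListAction using (sum)
  open import Data.Nat.ListAction.Properties using (sum-++)
  open import Data.Nat.Properties using (*-distribʳ-+; *-distribˡ-+; *-identityʳ; *-identityˡ; *-zeroʳ; +-commutativeSemigroup; +-identityʳ)
  open import Data.Product.Base using (_×_; _,_; ∃)
  open import Function.Base using (_∘_)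
  open import Function.Bundles using (_⇔_; Equivalence)
  open import Relation.Binary.Definitions using (DecidableEquality)
  open import Relation.Binary.PropositionalEquality
  open import Relation.Nullary.Decidable using (Dec; yes; no; does; _×-dec_)
  open import Relation.Nullary.Negation using (¬_; contradiction)
  open import Relation.Unary using (Decidable)

  𝟙 : ∀ {p} {P : Set p} → Dec P → ℕ
  𝟙 P? = if does P? then 1 else 0

  module _ {p} {P : Set p} where

    𝟙-yes : (P? : Dec P) → P → 𝟙 P? ≡ 1
    𝟙-yes (yes _) _ = refl
    𝟙-yes (no ¬p) p = contradiction p ¬p

    𝟙-no : (P? : Dec P) → ¬ P → 𝟙 P? ≡ 0
    𝟙-no (yes p) ¬p = contradiction p ¬p
    𝟙-no (no _)  _  = refl

  module _ {p q} {P : Set p} {Q : Set q} where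

    𝟙-cong : (P? : Dec P) (Q? : Dec Q) → P ⇔ Q → 𝟙 P? ≡ 𝟙 Q?
    𝟙-cong P? (yes q) P⇔Q = 𝟙-yes P? (Equivalence.from P⇔Q q)
    𝟙-cong P? (no ¬q) P⇔Q = 𝟙-no P? (¬q ∘ Equivalence.to P⇔Q)

    𝟙-× : (P? : Dec P) (Q? : Dec Q) → 𝟙 (P? ×-dec Q?) ≡ 𝟙 P? * 𝟙 Q?
    𝟙-× (yes _) (yes _) = refl
    𝟙-× (yes _) (no _)  = refl
    𝟙-× (no _)  _       = refl

  module _ {a} {A : Set a} where

    ∑ : List A → (A → ℕ) → ℕ
    ∑ xs f = sum (map f xs)

    ∑-cong : ∀ xs {f g : A → ℕ} → (∀ {x} → x ∈ xs → f x ≡ g x) → ∑ xs f ≡ ∑ xs g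
    ∑-cong []       _   = refl
    ∑-cong (x ∷ xs) f≗g = cong₂ _+_ (f≗g (here refl)) (∑-cong xs (f≗g ∘ there))

    ∑-const : ∀ xs k → ∑ xs (λ _ → k) ≡ length xs * k
    ∑-const []       k = refl
    ∑-const (x ∷ xs) k = cong (k +_) (∑-const xs k)

    length≡∑1 : ∀ xs → length xs ≡ ∑ xs (λ _ → 1)
    length≡∑1 xs = sym (trans (∑-const xs 1) (*-identityʳ (length xs)))

    ∑-++ : ∀ xs ys (f : A → ℕ) → ∑ (xs ++ ys) f ≡ ∑ xs f + ∑ ys f
    ∑-++ xs ys f = trans (cong sum (map-++ f xs ys)) (sum-++ (map f xs) (map f ys))

    ∑-+ : ∀ xs (f g : A → ℕ) → ∑ xs (λ x → f x + g x) ≡ ∑ xs f + ∑ xs g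
    ∑-+ []       f g = refl
    ∑-+ (x ∷ xs) f g = trans (cong (f x + g x +_) (∑-+ xs f g))
                             (interchange +-commutativeSemigroup (f x) (g x) (∑ xs f) (∑ xs g))

    ∑-*ˡ : ∀ xs (f : A → ℕ) k → ∑ xs (λ x → k * f x) ≡ k * ∑ xs f
    ∑-*ˡ []       f k = sym (*-zeroʳ k)
    ∑-*ˡ (x ∷ xs) f k = trans (cong (k * f x +_) (∑-*ˡ xs f k)) (sym (*-distribˡ-+ k (f x) (∑ xs f)))

    ∑-*ʳ : ∀ xs (f : A → ℕ) k → ∑ xs (λ x → f x * k) ≡ ∑ xs f * k
    ∑-*ʳ []       f k = refl
    ∑-*ʳ (x ∷ xs) f k = trans (cong (f x * k +_) (∑-*ʳ xs f k)) (sym (*-distribʳ-+ k (f x) (∑ xs f)))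

    module _ {q} {Q : A → Set q} (Q? : Decidable Q) where

      length-filter : ∀ xs → length (filter Q? xs) ≡ ∑ xs (𝟙 ∘ Q?)
      length-filter []       = refl
      length-filter (x ∷ xs) with does (Q? x)
      ... | true  = cong suc (length-filter xs)
      ... | false = length-filter xs

      ∑-filter : ∀ xs (f : A → ℕ) → ∑ (filter Q? xs) f ≡ ∑ xs (λ x → 𝟙 (Q? x) * f x)
      ∑-filter []       f = refl
      ∑-filter (x ∷ xs) f with does (Q? x)
      ... | true  = cong₂ _+_ (sym (+-identityʳ (f x))) (∑-filter xs f)
      ... | false = ∑-filter xs f

      ∑-none : ∀ xs (h : A → ℕ) → (∀ {y} → y ∈ xs → ¬ Q y) → ∑ xs (λ y → 𝟙 (Q? y) * h y) ≡ 0
      ∑-none []       h none = refl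
      ∑-none (y ∷ xs) h none = cong₂ _+_ (cong (_* h y) (𝟙-no (Q? y) (none (here refl)))) (∑-none xs h (none ∘ there))

      ∑-select : ∀ xs {x₀} (h : A → ℕ) → Unique xs → x₀ ∈ xs → (∀ {y} → y ∈ xs → Q y → y ≡ x₀) → Q x₀ →
                 ∑ xs (λ y → 𝟙 (Q? y) * h y) ≡ h x₀
      ∑-select (x₀ ∷ xs) h (x₀∉xs ∷ _) (here refl) only Qx₀ = begin
        𝟙 (Q? x₀) * h x₀ + ∑ xs (λ y → 𝟙 (Q? y) * h y)
          ≡⟨ cong₂ _+_ (cong (_* h x₀) (𝟙-yes (Q? x₀) Qx₀)) (∑-none xs h (λ y∈xs Qy → All.lookup x₀∉xs y∈xs (sym (only (there y∈xs) Qy)))) ⟩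
        1 * h x₀ + 0
          ≡⟨ trans (+-identityʳ _) (*-identityˡ _) ⟩
        h x₀ ∎
        where open ≡-Reasoning
      ∑-select (y ∷ xs) h (y∉xs ∷ unique) (there x₀∈xs) only Qx₀ =
        cong₂ _+_ (cong (_* h y) (𝟙-no (Q? y) (All.lookup y∉xs x₀∈xs ∘ only (here refl))))
                  (∑-select xs h unique x₀∈xs (only ∘ there) Qx₀)

  ∑-map : ∀ {a b} {A : Set a} {B : Set b} (g : A → B) xs (f : B → ℕ) → ∑ (map g xs) f ≡ ∑ xs (f ∘ g)
  ∑-map g xs f = cong sum (sym (map-∘ xs))

  module _ {a b} {A : Set a} {B : Set b} where

    ∑-swap : ∀ xs ys (h : A → B → ℕ) → ∑ xs (λ x → ∑ ys (h x)) ≡ ∑ ys (λ y → ∑ xs (λ x → h x y))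
    ∑-swap []       ys h = sym (trans (∑-const ys 0) (*-zeroʳ (length ys)))
    ∑-swap (x ∷ xs) ys h = trans (cong (∑ ys (h x) +_) (∑-swap xs ys h)) (sym (∑-+ ys (h x) _))

    length-cartesianProduct : ∀ (xs : List A) (ys : List B) → length (cartesianProduct xs ys) ≡ length xs * length ys
    length-cartesianProduct []       ys = refl
    length-cartesianProduct (x ∷ xs) ys =
      trans (length-++ (map (x ,_) ys)) (cong₂ _+_ (length-map (x ,_) ys) (length-cartesianProduct xs ys))

    ∑-cartesianProduct : ∀ xs ys (h : A × B → ℕ) →
                         ∑ (cartesianProduct xs ys) h ≡ ∑ xs (λ x → ∑ ys (λ y → h (x , y)))
    ∑-cartesianProduct []       ys h = refl
    ∑-cartesianProduct (x ∷ xs) ys h =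
      trans (∑-++ (map (x ,_) ys) _ h) (cong₂ _+_ (∑-map (x ,_) ys h) (∑-cartesianProduct xs ys h))

    -- Both sides equal ∑ over x ∈ xs and y ∈ ys of [φ y ≡ x] · f x.
    ∑-reindex : (_≟_ : DecidableEquality A) (φ : B → A) {xs : List A} {ys : List B} →
                Unique xs → Unique ys →
                (∀ {y} → y ∈ ys → φ y ∈ xs) →
                (∀ {x} → x ∈ xs → ∃ λ y → y ∈ ys × φ y ≡ x) →
                (∀ {y y′} → y ∈ ys → y′ ∈ ys → φ y ≡ φ y′ → y ≡ y′) →
                ∀ f → ∑ xs f ≡ ∑ ys (f ∘ φ)
    ∑-reindex _≟_ φ {xs} {ys} unique-xs unique-ys into onto injective f = begin
      ∑ xs f                                                 ≡⟨ ∑-cong xs (sym ∘ fibre) ⟩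
      ∑ xs (λ x → ∑ ys (λ y → 𝟙 (φ y ≟ x) * f (φ y)))        ≡⟨ ∑-swap xs ys _ ⟩
      ∑ ys (λ y → ∑ xs (λ x → 𝟙 (φ y ≟ x) * f (φ y)))        ≡⟨ ∑-cong ys (λ y∈ys → ∑-select (φ _ ≟_) xs _ unique-xs (into y∈ys) (λ _ → sym) refl) ⟩
      ∑ ys (f ∘ φ)                                           ∎
      where
      open ≡-Reasoning
      fibre : ∀ {x} → x ∈ xs → ∑ ys (λ y → 𝟙 (φ y ≟ x) * f (φ y)) ≡ f x
      fibre x∈xs with y , y∈ys , refl ← onto x∈xs =
        ∑-select (λ y′ → φ y′ ≟ φ y) ys (f ∘ φ) unique-ys y∈ys (λ y′∈ys → injective y′∈ys y∈ys) refl

module SGBGraph where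
  open ListSums
  open import Data.Bool.Base using (if_then_else_)
  open import Data.Fin.Base using (Fin)
  open import Data.Fin.Subset using (Subset; inside; outside; _⊆_) renaming (_∈_ to _∈ₛ_)
  open import Data.Fin.Subset.Properties using (_∈?_; _⊆?_; ⊆-antisym)
  open import Data.List.Base using ([]; _∷_; map; filter; length; allFin; cartesianProduct)
  open import Data.List.Membership.Propositional using (_∈_)
  open import Data.List.Membership.Propositional.Properties using (∈-map⁺; ∈-map⁻; ∈-++⁺ˡ; ∈-++⁺ʳ; ∈-filter⁺; ∈-filter⁻)
  open import Data.List.Properties using (length-tabulate)
  import Data.List.Relation.Unary.All as All
  open import Data.List.Relation.Unary.Any using (here)
  open import Data.List.Relation.Unary.Unique.Propositional using (Unique; []; _∷_)
  import Data.List.Relation.Unary.Unique.Propositional.Properties as Unique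
  open import Data.Nat.Base using (ℕ; zero; suc; _+_; _*_)
  open import Data.Nat.Properties using (*-identityˡ; *-identityʳ; *-comm)
  open import Data.Product.Base using (_×_; _,_; proj₁; proj₂)
  open import Data.Vec.Base using ([]; _∷_; tabulate)
  open import Data.Vec.Properties using (lookup⇒[]=; []=⇒lookup; lookup∘tabulate; ∷-injectiveˡ; ∷-injectiveʳ)
  open import Function.Base using (id)
  open import Function.Bundles using (_⇔_; mk⇔)
  open import Relation.Binary.PropositionalEquality
  open import Relation.Nullary.Decidable using (yes; no; does; dec-true; _→-dec_; _×-dec_)
  open import Relation.Nullary.Negation using (¬_)
  open import Relation.Unary using (Decidable)

  subsetOf : ∀ {n p} {P : Fin n → Set p} → Decidable P → Subset n
  subsetOf P? = tabulate (λ x → if does (P? x) then inside else outside)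

  module _ {n p} {P : Fin n → Set p} (P? : Decidable P) where

    ∈-subsetOf⁺ : ∀ {x} → P x → x ∈ₛ subsetOf P?
    ∈-subsetOf⁺ {x} Px = lookup⇒[]= x _ (trans (lookup∘tabulate _ x) (cong (if_then inside else outside) (dec-true (P? x) Px)))

    ∈-subsetOf⁻ : ∀ {x} → x ∈ₛ subsetOf P? → P x
    ∈-subsetOf⁻ {x} x∈ with P? x | trans (sym (lookup∘tabulate _ x)) ([]=⇒lookup x∈)
    ... | yes Px | _  = Px
    ... | no  _  | ()

  ∈-allSubsets : ∀ {n} (s : Subset n) → s ∈ allSubsets n
  ∈-allSubsets []            = here refl
  ∈-allSubsets (inside ∷ s)  = ∈-++⁺ˡ (∈-map⁺ (inside ∷_) (∈-allSubsets s))
  ∈-allSubsets (outside ∷ s) = ∈-++⁺ʳ _ (∈-map⁺ (outside ∷_) (∈-allSubsets s))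

  allSubsets-unique : ∀ n → Unique (allSubsets n)
  allSubsets-unique zero    = All.[] ∷ []
  allSubsets-unique (suc n) = Unique.++⁺ (Unique.map⁺ ∷-injectiveʳ (allSubsets-unique n))
                                         (Unique.map⁺ ∷-injectiveʳ (allSubsets-unique n))
                                         inside≢outside
    where
    inside≢outside : ∀ {v} → ¬ (v ∈ map (inside ∷_) (allSubsets n) × v ∈ map (outside ∷_) (allSubsets n))
    inside≢outside (v∈ , v∈′) with _ , _ , refl ← ∈-map⁻ (inside ∷_) v∈ | _ , _ , eq ← ∈-map⁻ (outside ∷_) v∈′ with () ← ∷-injectiveˡ eq

  module _ (G : FinGroup) where
    open FinGroup G

    InEverySubgroupContaining : Fin order → Fin order → Fin order → Set
    InEverySubgroupContaining a b x = ∀ K → IsSubgroup G K → a ∈ₛ K → b ∈ₛ K → x ∈ₛ K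

    inEverySubgroupContaining? : ∀ a b → Decidable (InEverySubgroupContaining a b)
    inEverySubgroupContaining? a b x = allSubset? λ K → isSubgroup? G K →-dec a ∈? K →-dec b ∈? K →-dec x ∈? K

    ⟨_,_⟩ : Fin order → Fin order → Subset order
    ⟨ a , b ⟩ = subsetOf (inEverySubgroupContaining? a b)

    module _ {a b : Fin order} where

      ∈-⟨,⟩⁻ : ∀ {x} → x ∈ₛ ⟨ a , b ⟩ → InEverySubgroupContaining a b x
      ∈-⟨,⟩⁻ = ∈-subsetOf⁻ (inEverySubgroupContaining? a b)

      ∈-⟨,⟩⁺ : ∀ {x} → InEverySubgroupContaining a b x → x ∈ₛ ⟨ a , b ⟩
      ∈-⟨,⟩⁺ = ∈-subsetOf⁺ (inEverySubgroupContaining? a b)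

    generates-⟨,⟩ : ∀ a b → Generates G a b ⟨ a , b ⟩
    generates-⟨,⟩ a b = (ε∈ , ∙∈ , ⁻¹∈) , ∈-⟨,⟩⁺ (λ _ _ a∈K _ → a∈K) , ∈-⟨,⟩⁺ (λ _ _ _ b∈K → b∈K) , least
      where
      ε∈ : ε ∈ₛ ⟨ a , b ⟩
      ε∈ = ∈-⟨,⟩⁺ λ K (ε∈K , _) _ _ → ε∈K
      ∙∈ : ∀ x y → x ∈ₛ ⟨ a , b ⟩ → y ∈ₛ ⟨ a , b ⟩ → (x ∙ y) ∈ₛ ⟨ a , b ⟩
      ∙∈ x y x∈ y∈ = ∈-⟨,⟩⁺ λ K K≤G@(_ , ∙∈K , _) a∈K b∈K →
        ∙∈K x y (∈-⟨,⟩⁻ x∈ K K≤G a∈K b∈K) (∈-⟨,⟩⁻ y∈ K K≤G a∈K b∈K)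
      ⁻¹∈ : ∀ x → x ∈ₛ ⟨ a , b ⟩ → (x ⁻¹) ∈ₛ ⟨ a , b ⟩
      ⁻¹∈ x x∈ = ∈-⟨,⟩⁺ λ K K≤G@(_ , _ , ⁻¹∈K) a∈K b∈K → ⁻¹∈K x (∈-⟨,⟩⁻ x∈ K K≤G a∈K b∈K)
      least : ∀ K → IsSubgroup G K → a ∈ₛ K → b ∈ₛ K → ⟨ a , b ⟩ ⊆ K
      least K K≤G a∈K b∈K x∈ = ∈-⟨,⟩⁻ x∈ K K≤G a∈K b∈K

    generates-unique : ∀ {a b H K} → Generates G a b H → Generates G a b K → H ≡ K
    generates-unique (H≤G , a∈H , b∈H , H-least) (K≤G , a∈K , b∈K , K-least) =
      ⊆-antisym (H-least _ K≤G a∈K b∈K) (K-least _ H≤G a∈H b∈H)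

    ⟨,⟩⊆⇔ : ∀ {a b K} → IsSubgroup G K → ⟨ a , b ⟩ ⊆ K ⇔ (a ∈ₛ K × b ∈ₛ K)
    ⟨,⟩⊆⇔ {a} {b} {K} K≤G = mk⇔ to (λ (a∈K , b∈K) → least K K≤G a∈K b∈K)
      where
      a∈ : a ∈ₛ ⟨ a , b ⟩
      a∈ = proj₁ (proj₂ (generates-⟨,⟩ a b))
      b∈ : b ∈ₛ ⟨ a , b ⟩
      b∈ = proj₁ (proj₂ (proj₂ (generates-⟨,⟩ a b)))
      least : ∀ K → IsSubgroup G K → a ∈ₛ K → b ∈ₛ K → ⟨ a , b ⟩ ⊆ K
      least = proj₂ (proj₂ (proj₂ (generates-⟨,⟩ a b)))
      to : ⟨ a , b ⟩ ⊆ K → a ∈ₛ K × b ∈ₛ K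
      to ⊆K = ⊆K a∈ , ⊆K b∈

    subgroups-unique : Unique (subgroups G)
    subgroups-unique = Unique.filter⁺ (isSubgroup? G) (allSubsets-unique order)

    ∈-subgroups⁺ : ∀ {H} → IsSubgroup G H → H ∈ subgroups G
    ∈-subgroups⁺ H≤G = ∈-filter⁺ (isSubgroup? G) (∈-allSubsets _) H≤G

    ∈-subgroups⁻ : ∀ {H} → H ∈ subgroups G → IsSubgroup G H
    ∈-subgroups⁻ H∈ = proj₂ (∈-filter⁻ (isSubgroup? G) {xs = allSubsets order} H∈)

    ∑-generated : ∀ a b (h : Subset order → ℕ) → ∑ (subgroups G) (λ H → 𝟙 (generates? G a b H) * h H) ≡ h ⟨ a , b ⟩
    ∑-generated a b h = ∑-select (generates? G a b) (subgroups G) h subgroups-unique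
      (∈-subgroups⁺ (proj₁ (generates-⟨,⟩ a b))) (λ _ gen → generates-unique gen (generates-⟨,⟩ a b)) (generates-⟨,⟩ a b)

    card : Subset order → ℕ
    card K = length (filter (_∈? K) (allFin order))

    length-pairs : length (pairs G) ≡ order * order
    length-pairs = trans (length-cartesianProduct (allFin order) (allFin order))
                         (cong₂ _*_ (length-tabulate {n = order} id) (length-tabulate {n = order} id))

    degPair≡1 : ∀ ab → degPair G ab ≡ 1
    degPair≡1 (a , b) = begin
      length (filter (generates? G a b) (subgroups G))        ≡⟨ length-filter (generates? G a b) (subgroups G) ⟩
      ∑ (subgroups G) (λ H → 𝟙 (generates? G a b H))          ≡⟨ ∑-cong (subgroups G) (λ _ → sym (*-identityʳ _)) ⟩
      ∑ (subgroups G) (λ H → 𝟙 (generates? G a b H) * 1)      ≡⟨ ∑-generated a b (λ _ → 1) ⟩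
      1                                                        ∎
      where open ≡-Reasoning

    degSub≡∑ : ∀ H → degSub G H ≡ ∑ (pairs G) (λ (a , b) → 𝟙 (generates? G a b H))
    degSub≡∑ H = length-filter (λ (a , b) → generates? G a b H) (pairs G)

    ∑-edges : ∀ (w : (Fin order × Fin order) × Subset order → ℕ) →
              ∑ (edges G) w ≡ ∑ (pairs G) (λ (a , b) → ∑ (subgroups G) (λ H → 𝟙 (generates? G a b H) * w ((a , b) , H)))
    ∑-edges w = trans (∑-filter _ (cartesianProduct (pairs G) (subgroups G)) w)
                      (∑-cartesianProduct (pairs G) (subgroups G) _)

    numEdges≡order² : numEdges G ≡ order * order
    numEdges≡order² = begin
      length (edges G)                                                                    ≡⟨ length≡∑1 (edges G) ⟩
      ∑ (edges G) (λ _ → 1)                                                               ≡⟨ ∑-edges (λ _ → 1) ⟩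
      ∑ (pairs G) (λ (a , b) → ∑ (subgroups G) (λ H → 𝟙 (generates? G a b H) * 1))        ≡⟨ ∑-cong (pairs G) (λ {(a , b)} _ → ∑-generated a b (λ _ → 1)) ⟩
      ∑ (pairs G) (λ _ → 1)                                                               ≡⟨ length≡∑1 (pairs G) ⟨
      length (pairs G)                                                                    ≡⟨ length-pairs ⟩
      order * order                                                                       ∎
      where open ≡-Reasoning

    numVertices≡order²+|L| : numVertices G ≡ order * order + length (subgroups G)
    numVertices≡order²+|L| = cong (_+ length (subgroups G)) length-pairs

    M₂≡∑degSub² : M₂ G ≡ ∑ (subgroups G) (λ H → degSub G H * degSub G H)
    M₂≡∑degSub² = begin
      ∑ (edges G) (λ (ab , H) → degPair G ab * degSub G H)
        ≡⟨ ∑-cong (edges G) (λ {(ab , H)} _ → trans (cong (_* degSub G H) (degPair≡1 ab)) (*-identityˡ _)) ⟩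
      ∑ (edges G) (λ (_ , H) → degSub G H)
        ≡⟨ ∑-edges _ ⟩
      ∑ (pairs G) (λ (a , b) → ∑ (subgroups G) (λ H → 𝟙 (generates? G a b H) * degSub G H))
        ≡⟨ ∑-swap (pairs G) (subgroups G) _ ⟩
      ∑ (subgroups G) (λ H → ∑ (pairs G) (λ (a , b) → 𝟙 (generates? G a b H) * degSub G H))
        ≡⟨ ∑-cong (subgroups G) (λ {H} _ → trans (∑-*ʳ (pairs G) _ (degSub G H)) (cong (_* degSub G H) (sym (degSub≡∑ H)))) ⟩
      ∑ (subgroups G) (λ H → degSub G H * degSub G H)
        ∎
      where open ≡-Reasoning

    M₁≡order²+∑degSub² : M₁ G ≡ order * order + ∑ (subgroups G) (λ H → degSub G H * degSub G H)
    M₁≡order²+∑degSub² = cong (_+ ∑ (subgroups G) (λ H → degSub G H * degSub G H)) (begin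
      ∑ (pairs G) (λ ab → degPair G ab * degPair G ab) ≡⟨ ∑-cong (pairs G) (λ {ab} _ → cong₂ _*_ (degPair≡1 ab) (degPair≡1 ab)) ⟩
      ∑ (pairs G) (λ _ → 1)                             ≡⟨ length≡∑1 (pairs G) ⟨
      length (pairs G)                                  ≡⟨ length-pairs ⟩
      order * order                                     ∎)
      where open ≡-Reasoning

    -- Summing over H ⊆ K counts the pairs (a , b) with ⟨ a , b ⟩ ⊆ K, i.e. the pairs in K × K.
    ∑-degSub-⊆ : ∀ {K} → IsSubgroup G K → ∑ (subgroups G) (λ H → 𝟙 (H ⊆? K) * degSub G H) ≡ card K * card K
    ∑-degSub-⊆ {K} K≤G = begin
      ∑ (subgroups G) (λ H → 𝟙 (H ⊆? K) * degSub G H)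
        ≡⟨ ∑-cong (subgroups G) (λ {H} _ → trans (cong (𝟙 (H ⊆? K) *_) (degSub≡∑ H)) (sym (∑-*ˡ (pairs G) _ (𝟙 (H ⊆? K))))) ⟩
      ∑ (subgroups G) (λ H → ∑ (pairs G) (λ (a , b) → 𝟙 (H ⊆? K) * 𝟙 (generates? G a b H)))
        ≡⟨ ∑-swap (subgroups G) (pairs G) _ ⟩
      ∑ (pairs G) (λ (a , b) → ∑ (subgroups G) (λ H → 𝟙 (H ⊆? K) * 𝟙 (generates? G a b H)))
        ≡⟨ ∑-cong (pairs G) (λ {(a , b)} _ → trans (∑-cong (subgroups G) (λ {H} _ → *-comm (𝟙 (H ⊆? K)) _)) (∑-generated a b (λ H → 𝟙 (H ⊆? K)))) ⟩
      ∑ (pairs G) (λ (a , b) → 𝟙 (⟨ a , b ⟩ ⊆? K))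
        ≡⟨ ∑-cong (pairs G) (λ {(a , b)} _ → trans (𝟙-cong (⟨ a , b ⟩ ⊆? K) (a ∈? K ×-dec b ∈? K) (⟨,⟩⊆⇔ K≤G)) (𝟙-× (a ∈? K) (b ∈? K))) ⟩
      ∑ (pairs G) (λ (a , b) → 𝟙 (a ∈? K) * 𝟙 (b ∈? K))
        ≡⟨ ∑-cartesianProduct (allFin order) (allFin order) _ ⟩
      ∑ (allFin order) (λ a → ∑ (allFin order) (λ b → 𝟙 (a ∈? K) * 𝟙 (b ∈? K)))
        ≡⟨ ∑-cong (allFin order) (λ {a} _ → ∑-*ˡ (allFin order) _ (𝟙 (a ∈? K))) ⟩
      ∑ (allFin order) (λ a → 𝟙 (a ∈? K) * ∑ (allFin order) (λ b → 𝟙 (b ∈? K)))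
        ≡⟨ ∑-*ʳ (allFin order) _ _ ⟩
      ∑ (allFin order) (λ a → 𝟙 (a ∈? K)) * ∑ (allFin order) (λ b → 𝟙 (b ∈? K))
        ≡⟨ cong₂ _*_ (length-filter (_∈? K) (allFin order)) (length-filter (_∈? K) (allFin order)) ⟨
      card K * card K
        ∎
      where open ≡-Reasoning

module CyclicGroups where
  open ListSums
  open SGBGraph
  open import Algebra.Bundles using (Group)
  import Algebra.Properties.Group as GroupProperties
  open import Algebra.Structures using (IsGroup)
  import Data.Bool.Properties as Bool
  open import Data.Fin.Base using (Fin; toℕ; fromℕ<)
  open import Data.Fin.Properties using (_≟_; pigeonhole; toℕ<n; toℕ-fromℕ<; injective⇒≤)
  open import Data.Fin.Subset using (Subset; _⊆_) renaming (_∈_ to _∈ₛ_)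
  open import Data.Fin.Subset.Properties using (_∈?_; _⊆?_; ⊆-antisym)
  open import Data.List.Base using (List; filter; length; allFin; upTo)
  open import Data.List.Membership.Propositional using (_∈_)
  open import Data.List.Membership.Propositional.Properties using (∈-filter⁺; ∈-filter⁻; ∈-allFin; ∈-upTo⁺; ∈-upTo⁻)
  open import Data.List.Properties using (length-upTo)
  open import Data.List.Relation.Unary.Unique.Propositional using (Unique)
  import Data.List.Relation.Unary.Unique.Propositional.Properties as Unique
  open import Data.Nat.Base using (ℕ; zero; suc; pred; _+_; _*_; _∸_; _≤_; _<_; z≤n; s≤s⁻¹; NonZero; >-nonZero; _%_; _/_)
  open import Data.Nat.DivMod using (m≡m%n+[m/n]*n; m%n<n)
  open import Data.Nat.Divisibility using (_∣_; _∣?_; divides; _∣0; ∣-refl; ∣-trans; ∣-antisym; ∣m∣n⇒∣m+n; ∣m+n∣m⇒∣n; %-presˡ-∣; ∣n∣m%n⇒∣m; m%n≡0⇒n∣m; m∣m*n)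
  open import Data.Nat.Induction using (<-rec)
  open import Data.Nat.Properties using (*-cancelˡ-<; *-cancelˡ-≡; *-comm; *-monoʳ-<; <-cmp; <⇒≤; <⇒≱; anyUpTo?; m*n≢0⇒m≢0; m+[n∸m]≡n; m<n⇒0<n∸m; m∸n+n≡m; m∸n≤m; n<1+n; suc-pred; ≤-<-trans; ≤-antisym; ≤-trans)
  open import Data.Product.Base using (_×_; _,_; proj₁; proj₂; ∃)
  open import Data.Vec.Properties using (≡-dec)
  open import Function.Base using (_∘_)
  open import Function.Bundles using (_⇔_; mk⇔; Equivalence)
  open import Level using (0ℓ)
  open import Relation.Binary.Definitions using (tri<; tri≈; tri>)
  open import Relation.Binary.PropositionalEquality
  open import Relation.Nullary.Decidable using (yes; no)
  open import Relation.Nullary.Negation using (¬_; contradiction)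
  open import Relation.Unary using (Decidable)

  least-witness : ∀ {p} {P : ℕ → Set p} → Decidable P → ∀ {k} → P k → ∃ λ m → P m × (∀ {i} → i < m → ¬ P i)
  least-witness {p} {P} P? {k} = <-rec (λ k → P k → Least) step k
    where
    Least : Set p
    Least = ∃ λ m → P m × (∀ {i} → i < m → ¬ P i)
    step : ∀ k → (∀ {j} → j < k → P j → Least) → P k → Least
    step k smaller Pk with anyUpTo? P? k
    ... | yes (j , j<k , Pj) = smaller j<k Pj
    ... | no  none           = k , Pk , λ i<k Pi → none (_ , i<k , Pi)

  module _ (G : FinGroup) where
    open FinGroup G
    open IsGroup isGroup using (assoc; identityˡ; identityʳ)

    pow-+ : ∀ x i j → pow G x (i + j) ≡ pow G x i ∙ pow G x j
    pow-+ x zero    j = sym (identityˡ _)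
    pow-+ x (suc i) j = trans (cong (x ∙_) (pow-+ x i j)) (sym (assoc _ _ _))

    pow-*-ε : ∀ {x t} → pow G x t ≡ ε → ∀ k → pow G x (k * t) ≡ ε
    pow-*-ε         xᵗ≡ε zero    = refl
    pow-*-ε {x} {t} xᵗ≡ε (suc k) = begin
      pow G x (t + k * t)           ≡⟨ pow-+ x t (k * t) ⟩
      pow G x t ∙ pow G x (k * t)   ≡⟨ cong₂ _∙_ xᵗ≡ε (pow-*-ε xᵗ≡ε k) ⟩
      ε ∙ ε                         ≡⟨ identityˡ ε ⟩
      ε                             ∎
      where open ≡-Reasoning

    pow-% : ∀ {x t} .{{_ : NonZero t}} → pow G x t ≡ ε → ∀ i → pow G x i ≡ pow G x (i % t)
    pow-% {x} {t} xᵗ≡ε i = begin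
      pow G x i                                   ≡⟨ cong (pow G x) (m≡m%n+[m/n]*n i t) ⟩
      pow G x (i % t + (i / t) * t)               ≡⟨ pow-+ x (i % t) _ ⟩
      pow G x (i % t) ∙ pow G x ((i / t) * t)     ≡⟨ cong (pow G x (i % t) ∙_) (pow-*-ε xᵗ≡ε (i / t)) ⟩
      pow G x (i % t) ∙ ε                         ≡⟨ identityʳ _ ⟩
      pow G x (i % t)                             ∎
      where open ≡-Reasoning

  module CyclicGroup (G : FinGroup) (cyclic : IsCyclic G) where
    open FinGroup G
    open IsGroup isGroup using (identityʳ)

    group : Group 0ℓ 0ℓ
    group = record { isGroup = isGroup }

    open GroupProperties group using (identityʳ-unique; inverseˡ-unique; x≈z//y)

    g : Fin order
    g = proj₁ cyclic

    infix 30 g^_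
    g^_ : ℕ → Fin order
    g^_ = pow G g

    order>0 : 0 < order
    order>0 = ≤-<-trans z≤n (toℕ<n ε)

    instance
      order≢0 : NonZero order
      order≢0 = >-nonZero order>0

    g^i≡g^j⇒g^[j∸i]≡ε : ∀ {i j} → i ≤ j → g^ i ≡ g^ j → g^ (j ∸ i) ≡ ε
    g^i≡g^j⇒g^[j∸i]≡ε {i} {j} i≤j gⁱ≡gʲ = identityʳ-unique (g^ i) _ (begin
      g^ i ∙ g^ (j ∸ i)   ≡⟨ pow-+ G g i (j ∸ i) ⟨
      g^ (i + (j ∸ i))    ≡⟨ cong g^_ (m+[n∸m]≡n i≤j) ⟩
      g^ j                ≡⟨ gⁱ≡gʲ ⟨
      g^ i                ∎)
      where open ≡-Reasoning

    -- Reducing the exponents of all elements modulo a period t injects G into Fin t.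
    period≥order : ∀ {t} → 0 < t → g^ t ≡ ε → order ≤ t
    period≥order {t} t>0 gᵗ≡ε = injective⇒≤ {f = reduce} λ {x} {y} eq → begin
      x                        ≡⟨ g^reduce x ⟨
      g^ toℕ (reduce x)        ≡⟨ cong (g^_ ∘ toℕ) eq ⟩
      g^ toℕ (reduce y)        ≡⟨ g^reduce y ⟩
      y                        ∎
      where
      open ≡-Reasoning
      instance
        t≢0 : NonZero t
        t≢0 = >-nonZero t>0
      reduce : Fin order → Fin t
      reduce x = fromℕ< (m%n<n (proj₁ (proj₂ cyclic x)) t)
      g^reduce : ∀ x → g^ toℕ (reduce x) ≡ x
      g^reduce x = begin
        g^ toℕ (reduce x)                      ≡⟨ cong g^_ (toℕ-fromℕ< (m%n<n (proj₁ (proj₂ cyclic x)) t)) ⟩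
        g^ (proj₁ (proj₂ cyclic x) % t)        ≡⟨ pow-% G gᵗ≡ε _ ⟨
        g^ proj₁ (proj₂ cyclic x)              ≡⟨ proj₂ (proj₂ cyclic x) ⟨
        x                                      ∎

    g^order≡ε : g^ order ≡ ε
    g^order≡ε with i , j , i<j , gⁱ≡gʲ ← pigeonhole (n<1+n order) (λ (i : Fin (suc order)) → g^ toℕ i) =
      subst (λ t → g^ t ≡ ε) (≤-antisym t≤order (period≥order (m<n⇒0<n∸m i<j) gᵗ≡ε)) gᵗ≡ε
      where
      gᵗ≡ε : g^ (toℕ j ∸ toℕ i) ≡ ε
      gᵗ≡ε = g^i≡g^j⇒g^[j∸i]≡ε (<⇒≤ i<j) gⁱ≡gʲ
      t≤order : toℕ j ∸ toℕ i ≤ order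
      t≤order = ≤-trans (m∸n≤m (toℕ j) (toℕ i)) (s≤s⁻¹ (toℕ<n j))

    g^-injective : ∀ {i j} → i < order → j < order → g^ i ≡ g^ j → i ≡ j
    g^-injective {i} {j} i<order j<order gⁱ≡gʲ with <-cmp i j
    ... | tri≈ _ i≡j _ = i≡j
    ... | tri< i<j _ _ = contradiction (period≥order (m<n⇒0<n∸m i<j) (g^i≡g^j⇒g^[j∸i]≡ε (<⇒≤ i<j) gⁱ≡gʲ))
                                       (<⇒≱ (≤-<-trans (m∸n≤m j i) j<order))
    ... | tri> _ _ j<i = contradiction (period≥order (m<n⇒0<n∸m j<i) (g^i≡g^j⇒g^[j∸i]≡ε (<⇒≤ j<i) (sym gⁱ≡gʲ)))
                                       (<⇒≱ (≤-<-trans (m∸n≤m i j) i<order))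

    log : Fin order → ℕ
    log x = proj₁ (proj₂ cyclic x) % order

    log<order : ∀ x → log x < order
    log<order x = m%n<n _ order

    g^log : ∀ x → g^ log x ≡ x
    g^log x = sym (trans (proj₂ (proj₂ cyclic x)) (pow-% G g^order≡ε _))

    log-g^ : ∀ i → log (g^ i) ≡ i % order
    log-g^ i = g^-injective (log<order (g^ i)) (m%n<n i order) (trans (g^log (g^ i)) (pow-% G g^order≡ε i))

    S : ℕ → Subset order
    S d = subsetOf (λ x → d ∣? log x)

    ∈S⇔ : ∀ {d x} → x ∈ₛ S d ⇔ d ∣ log x
    ∈S⇔ {d} = mk⇔ (∈-subsetOf⁻ (λ x → d ∣? log x)) (∈-subsetOf⁺ (λ x → d ∣? log x))

    module _ {d} (d∣order : d ∣ order) where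

      g^∈S⇔ : ∀ {i} → g^ i ∈ₛ S d ⇔ d ∣ i
      g^∈S⇔ {i} = mk⇔ (λ gⁱ∈S → ∣n∣m%n⇒∣m d∣order (subst (d ∣_) (log-g^ i) (Equivalence.to ∈S⇔ gⁱ∈S)))
                      (λ d∣i → Equivalence.from ∈S⇔ (subst (d ∣_) (sym (log-g^ i)) (%-presˡ-∣ d∣i d∣order)))

      S-isSubgroup : IsSubgroup G (S d)
      S-isSubgroup = Equivalence.from g^∈S⇔ (d ∣0) , ∙∈ , ⁻¹∈
        where
        d∣log : ∀ {x} → x ∈ₛ S d → d ∣ log x
        d∣log = Equivalence.to ∈S⇔
        ∙∈ : ∀ x y → x ∈ₛ S d → y ∈ₛ S d → (x ∙ y) ∈ₛ S d
        ∙∈ x y x∈ y∈ = subst (_∈ₛ S d) (trans (pow-+ G g (log x) (log y)) (cong₂ _∙_ (g^log x) (g^log y)))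
                             (Equivalence.from g^∈S⇔ (∣m∣n⇒∣m+n (d∣log x∈) (d∣log y∈)))
        ⁻¹∈ : ∀ x → x ∈ₛ S d → (x ⁻¹) ∈ₛ S d
        ⁻¹∈ x x∈ = subst (_∈ₛ S d) (inverseˡ-unique _ x (begin
            g^ (order ∸ log x) ∙ x              ≡⟨ cong (g^ (order ∸ log x) ∙_) (g^log x) ⟨
            g^ (order ∸ log x) ∙ g^ log x       ≡⟨ pow-+ G g (order ∸ log x) (log x) ⟨
            g^ (order ∸ log x + log x)          ≡⟨ cong g^_ (m∸n+n≡m (<⇒≤ (log<order x))) ⟩
            g^ order                            ≡⟨ g^order≡ε ⟩
            ε                                   ∎))
          (Equivalence.from g^∈S⇔ (∣m+n∣m⇒∣n (subst (d ∣_) (sym (m+[n∸m]≡n (<⇒≤ (log<order x)))) d∣order) (d∣log x∈)))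
          where open ≡-Reasoning

    -- H = S d for the least positive exponent d of an element of H, by division with remainder.
    subgroup≡S : ∀ {H} → IsSubgroup G H → ∃ λ d → d ∣ order × H ≡ S d
    subgroup≡S {H} (ε∈H , ∙∈H , ⁻¹∈H) =
      d , Equivalence.to (g^∈H⇔ order) g^order∈H ,
      ⊆-antisym (λ {x} x∈H → Equivalence.from ∈S⇔ (Equivalence.to (g^∈H⇔ (log x)) (subst (_∈ₛ H) (sym (g^log x)) x∈H)))
                (λ {x} x∈S → subst (_∈ₛ H) (g^log x) (Equivalence.from (g^∈H⇔ (log x)) (Equivalence.to ∈S⇔ x∈S)))
      where
      g^order∈H : g^ order ∈ₛ H
      g^order∈H = subst (_∈ₛ H) (sym g^order≡ε) ε∈H
      least : ∃ λ m → g^ suc m ∈ₛ H × (∀ {r} → r < m → ¬ g^ suc r ∈ₛ H)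
      least = least-witness (λ m → g^ suc m ∈? H) {pred order} (subst (λ t → g^ t ∈ₛ H) (sym (suc-pred order)) g^order∈H)
      d : ℕ
      d = suc (proj₁ least)
      gᵈ∈H : g^ d ∈ₛ H
      gᵈ∈H = proj₁ (proj₂ least)
      minimal : ∀ {r} → r < proj₁ least → ¬ g^ suc r ∈ₛ H
      minimal = proj₂ (proj₂ least)
      multiple∈H : ∀ k → g^ (k * d) ∈ₛ H
      multiple∈H zero    = ε∈H
      multiple∈H (suc k) = subst (_∈ₛ H) (sym (pow-+ G g d (k * d))) (∙∈H _ _ gᵈ∈H (multiple∈H k))
      remainder∈H : ∀ i → g^ i ∈ₛ H → g^ (i % d) ∈ₛ H
      remainder∈H i gⁱ∈H = subst (_∈ₛ H) (sym (x≈z//y _ _ _ (begin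
          g^ (i % d) ∙ g^ ((i / d) * d)   ≡⟨ pow-+ G g (i % d) _ ⟨
          g^ (i % d + (i / d) * d)        ≡⟨ cong g^_ (m≡m%n+[m/n]*n i d) ⟨
          g^ i                            ∎)))
        (∙∈H _ _ gⁱ∈H (⁻¹∈H _ (multiple∈H (i / d))))
        where open ≡-Reasoning
      below-d : ∀ {r} → r < d → g^ r ∈ₛ H → r ≡ 0
      below-d {zero}  _   _      = refl
      below-d {suc r} r<d gʳ⁺¹∈H = contradiction gʳ⁺¹∈H (minimal (s≤s⁻¹ r<d))
      g^∈H⇔ : ∀ i → g^ i ∈ₛ H ⇔ d ∣ i
      g^∈H⇔ i = mk⇔ (λ gⁱ∈H → m%n≡0⇒n∣m i d (below-d (m%n<n i d) (remainder∈H i gⁱ∈H)))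
                    (λ (divides k i≡k*d) → subst (λ j → g^ j ∈ₛ H) (sym i≡k*d) (multiple∈H k))

    S⊆S⇔ : ∀ {d d′} → d ∣ order → d′ ∣ order → S d ⊆ S d′ ⇔ d′ ∣ d
    S⊆S⇔ d∣order d′∣order =
      mk⇔ (λ S⊆S′ → Equivalence.to (g^∈S⇔ d′∣order) (S⊆S′ (Equivalence.from (g^∈S⇔ d∣order) ∣-refl)))
          (λ d′∣d {x} x∈S → Equivalence.from ∈S⇔ (∣-trans d′∣d (Equivalence.to ∈S⇔ x∈S)))

    S-injective : ∀ {d d′} → d ∣ order → d′ ∣ order → S d ≡ S d′ → d ≡ d′
    S-injective d∣order d′∣order S≡S′ =
      ∣-antisym (Equivalence.to (S⊆S⇔ d′∣order d∣order) (subst (_ ∈ₛ_) (sym S≡S′)))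
                (Equivalence.to (S⊆S⇔ d∣order d′∣order) (subst (_ ∈ₛ_) S≡S′))

    -- k ↦ g^(d k) enumerates S d without repetition for k < m.
    card-S : ∀ {d m} → order ≡ d * m → card G (S d) ≡ m
    card-S {d} {m} order≡d*m = begin
      length elements               ≡⟨ length≡∑1 elements ⟩
      ∑ elements (λ _ → 1)          ≡⟨ ∑-reindex _≟_ (λ k → g^ (d * k)) (Unique.filter⁺ (_∈? S d) (Unique.allFin⁺ order)) (Unique.upTo⁺ m) into onto injective _ ⟩
      ∑ (upTo m) (λ _ → 1)          ≡⟨ length≡∑1 (upTo m) ⟨
      length (upTo m)               ≡⟨ length-upTo m ⟩
      m                             ∎
      where
      open ≡-Reasoning
      elements : List (Fin order)
      elements = filter (_∈? S d) (allFin order)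
      instance
        d≢0 : NonZero d
        d≢0 = m*n≢0⇒m≢0 d {{subst NonZero order≡d*m order≢0}}
      d∣order : d ∣ order
      d∣order = divides m (trans order≡d*m (*-comm d m))
      d*k<order : ∀ {k} → k ∈ upTo m → d * k < order
      d*k<order k∈ = subst (d * _ <_) (sym order≡d*m) (*-monoʳ-< d (∈-upTo⁻ k∈))
      into : ∀ {k} → k ∈ upTo m → g^ (d * k) ∈ elements
      into {k} _ = ∈-filter⁺ (_∈? S d) (∈-allFin _) (Equivalence.from (g^∈S⇔ d∣order) (m∣m*n k))
      onto : ∀ {x} → x ∈ elements → ∃ λ k → k ∈ upTo m × g^ (d * k) ≡ x
      onto {x} x∈ with divides k log≡k*d ← Equivalence.to ∈S⇔ (proj₂ (∈-filter⁻ (_∈? S d) {xs = allFin order} x∈)) =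
        k , ∈-upTo⁺ (*-cancelˡ-< d k m (subst₂ _<_ (sym d*k≡log) order≡d*m (log<order x))) , trans (cong g^_ d*k≡log) (g^log x)
        where
        d*k≡log : d * k ≡ log x
        d*k≡log = trans (*-comm d k) (sym log≡k*d)
      injective : ∀ {k k′} → k ∈ upTo m → k′ ∈ upTo m → g^ (d * k) ≡ g^ (d * k′) → k ≡ k′
      injective k∈ k′∈ eq = *-cancelˡ-≡ _ _ d (g^-injective (d*k<order k∈) (d*k<order k′∈) eq)

    module DivisorList {Ds : List ℕ} (Ds-unique : Unique Ds) (∈Ds⇔ : ∀ {d} → d ∈ Ds ⇔ d ∣ order) where

      ∑-subgroups : ∀ f → ∑ (subgroups G) f ≡ ∑ Ds (f ∘ S)
      ∑-subgroups = ∑-reindex (≡-dec Bool._≟_) S (subgroups-unique G) Ds-unique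
        (λ d∈Ds → ∈-subgroups⁺ G (S-isSubgroup (Equivalence.to ∈Ds⇔ d∈Ds)))
        (λ H∈ → let d , d∣order , H≡S = subgroup≡S (∈-subgroups⁻ G H∈) in d , Equivalence.from ∈Ds⇔ d∣order , sym H≡S)
        (λ d∈Ds d′∈Ds → S-injective (Equivalence.to ∈Ds⇔ d∈Ds) (Equivalence.to ∈Ds⇔ d′∈Ds))

      length-subgroups : length (subgroups G) ≡ length Ds
      length-subgroups = trans (length≡∑1 (subgroups G)) (trans (∑-subgroups _) (sym (length≡∑1 Ds)))

      ∑-degSub-S : ∀ {d′ m} → d′ ∈ Ds → order ≡ d′ * m → ∑ Ds (λ d → 𝟙 (d′ ∣? d) * degSub G (S d)) ≡ m * m
      ∑-degSub-S {d′} {m} d′∈Ds order≡d′*m = begin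
        ∑ Ds (λ d → 𝟙 (d′ ∣? d) * degSub G (S d))
          ≡⟨ ∑-cong Ds (λ {d} d∈Ds → cong (_* degSub G (S d)) (sym (𝟙-cong (S d ⊆? S d′) (d′ ∣? d) (S⊆S⇔ (Equivalence.to ∈Ds⇔ d∈Ds) d′∣order)))) ⟩
        ∑ Ds (λ d → 𝟙 (S d ⊆? S d′) * degSub G (S d))
          ≡⟨ ∑-subgroups (λ H → 𝟙 (H ⊆? S d′) * degSub G H) ⟨
        ∑ (subgroups G) (λ H → 𝟙 (H ⊆? S d′) * degSub G H)
          ≡⟨ ∑-degSub-⊆ G (S-isSubgroup d′∣order) ⟩
        card G (S d′) * card G (S d′)
          ≡⟨ cong₂ _*_ (card-S {d′} order≡d′*m) (card-S {d′} order≡d′*m) ⟩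
        m * m
          ∎
        where
        open ≡-Reasoning
        d′∣order : d′ ∣ order
        d′∣order = Equivalence.to ∈Ds⇔ d′∈Ds

module PrimePowerDivisors where
  open ListSums
  open import Algebra.Properties.CommutativeSemigroup using (interchange)
  open import Data.List.Base using (List; map; cartesianProduct; upTo)
  open import Data.List.Membership.Propositional using (_∈_)
  open import Data.List.Membership.Propositional.Properties using (∈-map⁺; ∈-map⁻; ∈-cartesianProduct⁺; ∈-cartesianProduct⁻; ∈-upTo⁺; ∈-upTo⁻)
  open import Data.List.Relation.Unary.Unique.Propositional using (Unique)
  import Data.List.Relation.Unary.Unique.Propositional.Properties as Unique
  open import Data.Nat.Base using (ℕ; zero; suc; _*_; _^_; _∸_; _≤_; z≤n; s≤s; s≤s⁻¹; NonZero; nonTrivial⇒≢1)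
  open import Data.Nat.Coprimality using (Coprime; coprime-divisor)
  open import Data.Nat.Divisibility using (_∣_; _∣?_; divides; ∣-reflexive; ∣-trans; ∣1⇒≡1; m∣m*n; n∣m*n; *-pres-∣; *-cancelˡ-∣; *-cancelʳ-∣)
  open import Data.Nat.Primality using (Prime; prime⇒nonZero; prime⇒nonTrivial; prime⇒irreducible; euclidsLemma)
  open import Data.Nat.Properties using (*-assoc; *-comm; *-commutativeSemigroup; *-identityʳ; *-identityˡ; ^-distribˡ-+-*; m^n≢0; m∸n+n≡m; m≤n⇒m≤1+n; ≤-antisym; ≰⇒>; _≤?_)
  open import Data.Product.Base using (_×_; _,_; ∃₂)
  open import Data.Product.Properties using (×-≡,≡→≡)
  open import Data.Sum.Base using (inj₁; inj₂)
  open import Function.Base using (_∘_)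
  open import Function.Bundles using (_⇔_; mk⇔; Equivalence)
  open import Relation.Binary.PropositionalEquality
  open import Relation.Nullary.Decidable using (Dec; yes; no; _×-dec_)
  open import Relation.Nullary.Negation using (¬_; contradiction)

  ^-distribʳ-* : ∀ m n k → (m * n) ^ k ≡ m ^ k * n ^ k
  ^-distribʳ-* m n zero    = refl
  ^-distribʳ-* m n (suc k) = trans (cong (m * n *_) (^-distribʳ-* m n k)) (interchange *-commutativeSemigroup m n (m ^ k) (n ^ k))

  ^-monoʳ-∣ : ∀ m {i k} → i ≤ k → m ^ i ∣ m ^ k
  ^-monoʳ-∣ m {i} {k} i≤k = divides (m ^ (k ∸ i)) (trans (cong (m ^_) (sym (m∸n+n≡m i≤k))) (^-distribˡ-+-* m (k ∸ i) i))

  module _ {p} (p-prime : Prime p) where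
    private instance
      p≢0 : NonZero p
      p≢0 = prime⇒nonZero p-prime

    prime∤⇒coprime : ∀ {d} → ¬ p ∣ d → Coprime d p
    prime∤⇒coprime p∤d (i∣d , i∣p) with prime⇒irreducible p-prime i∣p
    ... | inj₁ i≡1 = i≡1
    ... | inj₂ refl = contradiction i∣d p∤d

    prime∤prime^ : ∀ {q} → Prime q → p ≢ q → ∀ l → ¬ p ∣ q ^ l
    prime∤prime^ q-prime p≢q zero    p∣1 = nonTrivial⇒≢1 {{prime⇒nonTrivial p-prime}} (∣1⇒≡1 p∣1)
    prime∤prime^ q-prime p≢q (suc l) p∣qˡ⁺¹ with euclidsLemma _ _ p-prime p∣qˡ⁺¹
    ... | inj₂ p∣qˡ = prime∤prime^ q-prime p≢q l p∣qˡ
    ... | inj₁ p∣q with prime⇒irreducible q-prime p∣q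
    ...   | inj₁ p≡1 = nonTrivial⇒≢1 {{prime⇒nonTrivial p-prime}} p≡1
    ...   | inj₂ p≡q = p≢q p≡q

    p^[1+a]*m≡p^a*m*p : ∀ a m → p ^ suc a * m ≡ p ^ a * m * p
    p^[1+a]*m≡p^a*m*p a m = trans (*-assoc p (p ^ a) m) (*-comm p (p ^ a * m))

    -- Induction on a: either p ∣ d, or d is coprime to p and so divides p ^ a * m.
    ∣p^a*m⇒ : ∀ a {d m} → d ∣ p ^ a * m → ∃₂ λ i e → i ≤ a × e ∣ m × d ≡ p ^ i * e
    ∣p^a*m⇒ zero    {d} {m} d∣m = 0 , d , z≤n , subst (d ∣_) (*-identityˡ m) d∣m , sym (*-identityˡ d)
    ∣p^a*m⇒ (suc a) {d} {m} d∣ with p ∣? d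
    ... | no p∤d with i , e , i≤a , e∣m , d≡pⁱe ← ∣p^a*m⇒ a (coprime-divisor (prime∤⇒coprime p∤d) (subst (d ∣_) (*-assoc p (p ^ a) m) d∣)) =
      i , e , m≤n⇒m≤1+n i≤a , e∣m , d≡pⁱe
    ... | yes (divides k d≡k*p) with i , e , i≤a , e∣m , k≡pⁱe ← ∣p^a*m⇒ a {k} (*-cancelʳ-∣ p (subst₂ _∣_ d≡k*p (p^[1+a]*m≡p^a*m*p a m) d∣)) =
      suc i , e , s≤s i≤a , e∣m , (begin
        d               ≡⟨ d≡k*p ⟩
        k * p           ≡⟨ cong (_* p) k≡pⁱe ⟩
        p ^ i * e * p   ≡⟨ p^[1+a]*m≡p^a*m*p i e ⟨
        p ^ suc i * e   ∎)
      where open ≡-Reasoning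

    p^i∣p^k*m⇒i≤k : ∀ {i k m} → ¬ p ∣ m → p ^ i ∣ p ^ k * m → i ≤ k
    p^i∣p^k*m⇒i≤k {i} {k} {m} p∤m pⁱ∣pᵏm with i ≤? k
    ... | yes i≤k = i≤k
    ... | no  i≰k = contradiction (*-cancelˡ-∣ (p ^ k) {{m^n≢0 p k}} (∣-trans pᵏp∣pⁱ pⁱ∣pᵏm)) p∤m
      where
      pᵏp∣pⁱ : p ^ k * p ∣ p ^ i
      pᵏp∣pⁱ = subst (_∣ p ^ i) (*-comm p (p ^ k)) (^-monoʳ-∣ p (≰⇒> i≰k))

  -- (i , j) ∈ exponents a b stands for the divisor p ^ i * q ^ j of p ^ a * q ^ b, and _≼_ for divisibility.
  exponents : ℕ → ℕ → List (ℕ × ℕ)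
  exponents a b = cartesianProduct (upTo (suc a)) (upTo (suc b))

  exponents-unique : ∀ a b → Unique (exponents a b)
  exponents-unique a b = Unique.cartesianProduct⁺ (Unique.upTo⁺ (suc a)) (Unique.upTo⁺ (suc b))

  ∈-exponents⇔ : ∀ {a b i j} → (i , j) ∈ exponents a b ⇔ (i ≤ a × j ≤ b)
  ∈-exponents⇔ {a} {b} = mk⇔ (λ e∈ → let i∈ , j∈ = ∈-cartesianProduct⁻ (upTo (suc a)) (upTo (suc b)) e∈ in s≤s⁻¹ (∈-upTo⁻ i∈) , s≤s⁻¹ (∈-upTo⁻ j∈))
                             (λ (i≤a , j≤b) → ∈-cartesianProduct⁺ (∈-upTo⁺ (s≤s i≤a)) (∈-upTo⁺ (s≤s j≤b)))

  _≼_ : ℕ × ℕ → ℕ × ℕ → Set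
  (i , j) ≼ (k , l) = i ≤ k × j ≤ l

  _≼?_ : ∀ e e′ → Dec (e ≼ e′)
  (i , j) ≼? (k , l) = (i ≤? k) ×-dec (j ≤? l)

  module _ (p q : ℕ) where

    p^q^ : ℕ × ℕ → ℕ
    p^q^ (i , j) = p ^ i * q ^ j

    divisors : ℕ → ℕ → List ℕ
    divisors a b = map p^q^ (exponents a b)

  module _ {p q} (p-prime : Prime p) (q-prime : Prime q) (p≢q : p ≢ q) where

    p^q^-∣⇔ : ∀ {e e′} → p^q^ p q e ∣ p^q^ p q e′ ⇔ e ≼ e′
    p^q^-∣⇔ {i , j} {k , l} = mk⇔
      (λ ∣ → p^i∣p^k*m⇒i≤k p-prime (prime∤prime^ p-prime q-prime p≢q l) (∣-trans (m∣m*n (q ^ j)) ∣)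
           , p^i∣p^k*m⇒i≤k q-prime (prime∤prime^ q-prime p-prime (p≢q ∘ sym) k)
                            (subst (q ^ j ∣_) (*-comm (p ^ k) (q ^ l)) (∣-trans (n∣m*n (p ^ i)) ∣)))
      (λ (i≤k , j≤l) → *-pres-∣ (^-monoʳ-∣ p i≤k) (^-monoʳ-∣ q j≤l))

    p^q^-injective : ∀ {e e′} → p^q^ p q e ≡ p^q^ p q e′ → e ≡ e′
    p^q^-injective {i , j} {k , l} eq
      with i≤k , j≤l ← Equivalence.to p^q^-∣⇔ (∣-reflexive eq) | k≤i , l≤j ← Equivalence.to p^q^-∣⇔ (∣-reflexive (sym eq)) =
      ×-≡,≡→≡ (≤-antisym i≤k k≤i , ≤-antisym j≤l l≤j)

    divisors-unique : ∀ a b → Unique (divisors p q a b)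
    divisors-unique a b = Unique.map⁺ p^q^-injective (exponents-unique a b)

    ∈-divisors⇔ : ∀ {a b d} → d ∈ divisors p q a b ⇔ d ∣ p ^ a * q ^ b
    ∈-divisors⇔ {a} {b} {d} = mk⇔ to from
      where
      to : d ∈ divisors p q a b → d ∣ p ^ a * q ^ b
      to d∈ with (i , j) , e∈ , refl ← ∈-map⁻ (p^q^ p q) {xs = exponents a b} d∈ = Equivalence.from (p^q^-∣⇔ {i , j} {a , b}) (Equivalence.to (∈-exponents⇔ {a} {b}) e∈)
      from : d ∣ p ^ a * q ^ b → d ∈ divisors p q a b
      from d∣ with i , e , i≤a , e∣qᵇ , refl ← ∣p^a*m⇒ p-prime a d∣
              with j , f , j≤b , f∣1 , refl ← ∣p^a*m⇒ q-prime b (subst (e ∣_) (sym (*-identityʳ (q ^ b))) e∣qᵇ)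
              with refl ← ∣1⇒≡1 f∣1 =
        subst (_∈ divisors p q a b) (cong (p ^ i *_) (sym (*-identityʳ (q ^ j)))) (∈-map⁺ (p^q^ p q) (Equivalence.from ∈-exponents⇔ (i≤a , j≤b)))

module CyclicOfOrderPᵃQᵇ (G : FinGroup) (cyclic : IsCyclic G) {p q} (p-prime : Prime p) (q-prime : Prime q) (p≢q : p ≢ q)
                         {a b} (order≡pᵃqᵇ : FinGroup.order G ≡ p ℕ.^ a ℕ.* q ℕ.^ b) where
  open import Algebra.Properties.CommutativeSemigroup using (interchange)
  open import Data.List.Base using (filter; length; upTo)
  open import Data.List.Membership.Propositional using (_∈_)
  open import Data.List.Membership.Propositional.Properties using (∈-map⁺)
  open import Data.List.Properties using (length-map; length-upTo)
  open import Data.Nat.Base using (ℕ; suc; _+_; _*_; _^_; _∸_; _≤_)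
  open import Data.Nat.Divisibility using (_∣_; _∣?_)
  open import Data.Nat.Properties using (*-commutativeSemigroup; ^-distribˡ-+-*; m+[n∸m]≡n)
  open import Data.Product.Base using (_×_; _,_; proj₁; proj₂)
  open import Function.Base using (_∘_)
  open import Function.Bundles using (_⇔_; mk⇔; Equivalence)
  open import Relation.Binary.PropositionalEquality
  open ListSums
  open SGBGraph
  open CyclicGroups
  open PrimePowerDivisors
  open FinGroup G using (order)
  open CyclicGroup G cyclic

  ∈divisors⇔∣order : ∀ {d} → d ∈ divisors p q a b ⇔ d ∣ order
  ∈divisors⇔∣order {d} = mk⇔ (subst (d ∣_) (sym order≡pᵃqᵇ) ∘ Equivalence.to (∈-divisors⇔ p-prime q-prime p≢q {a} {b}))
                             (Equivalence.from (∈-divisors⇔ p-prime q-prime p≢q {a} {b}) ∘ subst (d ∣_) order≡pᵃqᵇ)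

  open DivisorList (divisors-unique p-prime q-prime p≢q a b) ∈divisors⇔∣order

  degree : ℕ × ℕ → ℕ
  degree e = degSub G (S (p^q^ p q e))

  length-subgroups≡ : length (subgroups G) ≡ suc a * suc b
  length-subgroups≡ = begin
    length (subgroups G)                            ≡⟨ length-subgroups ⟩
    length (divisors p q a b)                       ≡⟨ length-map _ (exponents a b) ⟩
    length (exponents a b)                          ≡⟨ length-cartesianProduct (upTo (suc a)) (upTo (suc b)) ⟩
    length (upTo (suc a)) * length (upTo (suc b))   ≡⟨ cong₂ _*_ (length-upTo (suc a)) (length-upTo (suc b)) ⟩
    suc a * suc b                                   ∎
    where open ≡-Reasoning

  ∑-degSub² : ∑ (subgroups G) (λ H → degSub G H * degSub G H) ≡ ∑ (exponents a b) (λ e → degree e * degree e)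
  ∑-degSub² = trans (∑-subgroups _) (∑-map (p^q^ p q) (exponents a b) _)

  cofactor : ℕ × ℕ → ℕ
  cofactor (i , j) = p ^ (a ∸ i) * q ^ (b ∸ j)

  order≡p^q^*cofactor : ∀ {i j} → i ≤ a → j ≤ b → order ≡ p^q^ p q (i , j) * cofactor (i , j)
  order≡p^q^*cofactor {i} {j} i≤a j≤b = begin
    order                                           ≡⟨ order≡pᵃqᵇ ⟩
    p ^ a * q ^ b                                   ≡⟨ cong₂ (λ k l → p ^ k * q ^ l) (m+[n∸m]≡n i≤a) (m+[n∸m]≡n j≤b) ⟨
    p ^ (i + (a ∸ i)) * q ^ (j + (b ∸ j))           ≡⟨ cong₂ _*_ (^-distribˡ-+-* p i (a ∸ i)) (^-distribˡ-+-* q j (b ∸ j)) ⟩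
    p ^ i * p ^ (a ∸ i) * (q ^ j * q ^ (b ∸ j))     ≡⟨ interchange *-commutativeSemigroup (p ^ i) _ _ _ ⟩
    p ^ i * q ^ j * (p ^ (a ∸ i) * q ^ (b ∸ j))     ∎
    where open ≡-Reasoning

  cofactor² : ∀ e → cofactor e * cofactor e ≡ (p * p) ^ (a ∸ proj₁ e) * (q * q) ^ (b ∸ proj₂ e)
  cofactor² (i , j) = trans (interchange *-commutativeSemigroup (p ^ (a ∸ i)) _ _ _)
                            (sym (cong₂ _*_ (^-distribʳ-* p p (a ∸ i)) (^-distribʳ-* q q (b ∸ j))))

  degree-system : ∀ {i j} → (i , j) ∈ exponents a b →
                  ∑ (filter ((i , j) ≼?_) (exponents a b)) degree ≡ (p * p) ^ (a ∸ i) * (q * q) ^ (b ∸ j)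
  degree-system {i} {j} e∈ with i≤a , j≤b ← Equivalence.to ∈-exponents⇔ e∈ = begin
    ∑ (filter ((i , j) ≼?_) (exponents a b)) degree
      ≡⟨ ∑-filter ((i , j) ≼?_) (exponents a b) degree ⟩
    ∑ (exponents a b) (λ e → 𝟙 ((i , j) ≼? e) * degree e)
      ≡⟨ ∑-cong (exponents a b) (λ {e} _ → cong (_* degree e) (𝟙-cong (p^q^ p q (i , j) ∣? p^q^ p q e) ((i , j) ≼? e) (p^q^-∣⇔ p-prime q-prime p≢q))) ⟨
    ∑ (exponents a b) (λ e → 𝟙 (p^q^ p q (i , j) ∣? p^q^ p q e) * degree e)
      ≡⟨ ∑-map (p^q^ p q) (exponents a b) _ ⟨
    ∑ (divisors p q a b) (λ d → 𝟙 (p^q^ p q (i , j) ∣? d) * degSub G (S d))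
      ≡⟨ ∑-degSub-S (∈-map⁺ (p^q^ p q) e∈) (order≡p^q^*cofactor i≤a j≤b) ⟩
    cofactor (i , j) * cofactor (i , j)
      ≡⟨ cofactor² (i , j) ⟩
    (p * p) ^ (a ∸ i) * (q * q) ^ (b ∸ j)
      ∎
    where open ≡-Reasoning

module P²QArithmetic where
  open import Data.List.Base using ([]; _∷_; map; filter)
  open import Data.List.Membership.Propositional using (_∈_)
  open import Data.List.Relation.Binary.Pointwise using (Pointwise-≡⇒≡; []; _∷_)
  open import Data.Nat.Base using (ℕ; suc; _+_; _*_; _^_; _∸_; _≤_; _<_; z≤n; s≤s)
  open import Data.Nat.ListAction using (sum)
  open import Data.Nat.Properties using (*-identityʳ; *-identityˡ; *-mono-≤; *-monoʳ-<; *-monoʳ-≤; *-monoˡ-<; +-cancelʳ-≡; +-comm; +-identityʳ; +-monoˡ-<; ^-identityʳ; m≤m+n; m≤n+m; ≤-refl; module ≤-Reasoning)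
  open import Data.Nat.Solver using (module +-*-Solver)
  open import Data.Nat.Tactic.RingSolver using (solve-∀)
  open import Data.Product.Base using (_×_; _,_)
  open import Function.Base using (_∘_)
  open import Function.Bundles using (Equivalence)
  open import Relation.Binary.PropositionalEquality
  open ListSums
  open PrimePowerDivisors
  open +-*-Solver using (solve; _:+_; _:*_; _:=_; con)

  -- ∑ of J₂(d)² over the divisors d of p² and of q (J₂ is Jordan's totient), written with
  -- u = p² - 1 and v = q² - 1: J₂(1) = 1, J₂(p) = u, J₂(p²) = (1 + u) u and J₂(q) = v.
  sumJ₂²-p² : ℕ → ℕ
  sumJ₂²-p² u = 1 + u * u + suc u * u * (suc u * u)

  sumJ₂²-q : ℕ → ℕ
  sumJ₂²-q v = 1 + v * v

  P²Q : ℕ → ℕ → ℕ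
  P²Q u v = suc u * suc u * suc v

  -- P = 1 + u and Q = 1 + v stand for p² and q²; the system is solved from (2 , 1) downwards.
  p²q-system⇒∑c² : ∀ (c : ℕ × ℕ → ℕ) u v →
    (∀ {i j} → (i , j) ∈ exponents 2 1 → ∑ (filter ((i , j) ≼?_) (exponents 2 1)) c ≡ suc u ^ (2 ∸ i) * suc v ^ (1 ∸ j)) →
    ∑ (exponents 2 1) (λ e → c e * c e) ≡ sumJ₂²-p² u * sumJ₂²-q v
  p²q-system⇒∑c² c u v system = begin
    ∑ (exponents 2 1) (λ e → c e * c e)
      ≡⟨ cong (sum ∘ map (λ x → x * x)) (Pointwise-≡⇒≡ (c₀₀ ∷ c₀₁ ∷ c₁₀ ∷ c₁₁ ∷ c₂₀ ∷ c₂₁ ∷ [])) ⟩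
    sum (map (λ x → x * x) (P * u * v ∷ P * u ∷ u * v ∷ u ∷ v ∷ 1 ∷ []))
      ≡⟨ sum-of-squares u v ⟩
    sumJ₂²-p² u * sumJ₂²-q v
      ∎
    where
    open ≡-Reasoning
    P Q : ℕ
    P = suc u
    Q = suc v
    solve-for : ∀ {x y k t} → x + k ≡ t → y + k ≡ t → x ≡ y
    solve-for x+k≡t y+k≡t = +-cancelʳ-≡ _ _ _ (trans x+k≡t (sym y+k≡t))
    T : ∀ i j → i ≤ 2 → j ≤ 1 → ∑ (filter ((i , j) ≼?_) (exponents 2 1)) c ≡ P ^ (2 ∸ i) * Q ^ (1 ∸ j)
    T i j i≤2 j≤1 = system {i} {j} (Equivalence.from (∈-exponents⇔ {2} {1}) (i≤2 , j≤1))
    T₂₁ : ∑ ((2 , 1) ∷ []) c ≡ 1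
    T₂₁ = T 2 1 ≤-refl ≤-refl
    T₂₀ : ∑ ((2 , 0) ∷ (2 , 1) ∷ []) c ≡ Q
    T₂₀ = trans (T 2 0 ≤-refl z≤n) (trans (*-identityˡ _) (^-identityʳ Q))
    T₁₁ : ∑ ((1 , 1) ∷ (2 , 1) ∷ []) c ≡ P
    T₁₁ = trans (T 1 1 (s≤s z≤n) ≤-refl) (trans (*-identityʳ _) (^-identityʳ P))
    T₁₀ : ∑ ((1 , 0) ∷ (1 , 1) ∷ (2 , 0) ∷ (2 , 1) ∷ []) c ≡ P * Q
    T₁₀ = trans (T 1 0 (s≤s z≤n) z≤n) (cong₂ _*_ (^-identityʳ P) (^-identityʳ Q))
    T₀₁ : ∑ ((0 , 1) ∷ (1 , 1) ∷ (2 , 1) ∷ []) c ≡ P * P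
    T₀₁ = trans (T 0 1 z≤n ≤-refl) (trans (*-identityʳ _) (cong (P *_) (^-identityʳ P)))
    T₀₀ : ∑ (exponents 2 1) c ≡ P * P * Q
    T₀₀ = trans (T 0 0 z≤n z≤n) (cong₂ _*_ (cong (P *_) (^-identityʳ P)) (^-identityʳ Q))
    c₂₁ : c (2 , 1) ≡ 1
    c₂₁ = trans (sym (+-identityʳ _)) T₂₁
    c₁₁ : c (1 , 1) ≡ u
    c₁₁ = solve-for T₁₁ (trans (cong (u +_) T₂₁) (+-comm u 1))
    c₂₀ : c (2 , 0) ≡ v
    c₂₀ = solve-for T₂₀ (trans (cong (v +_) T₂₁) (+-comm v 1))
    c₀₁ : c (0 , 1) ≡ P * u
    c₀₁ = solve-for T₀₁ (trans (cong (P * u +_) T₁₁) (identity u))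
      where
      identity : ∀ u → suc u * u + suc u ≡ suc u * suc u
      identity = solve-∀
    c₁₀ : c (1 , 0) ≡ u * v
    c₁₀ = solve-for T₁₀ (trans (cong (u * v +_) (cong₂ _+_ c₁₁ T₂₀)) (identity u v))
      where
      identity : ∀ u v → u * v + (u + suc v) ≡ suc u * suc v
      identity = solve-∀
    c₀₀ : c (0 , 0) ≡ P * u * v
    c₀₀ = solve-for T₀₀ (trans (cong (P * u * v +_) (cong₂ _+_ c₀₁ T₁₀)) (identity u v))
      where
      identity : ∀ u v → suc u * u * v + (suc u * u + suc u * suc v) ≡ suc u * suc u * suc v
      identity = solve-∀
    sum-of-squares : ∀ u v → sum (map (λ x → x * x) (suc u * u * v ∷ suc u * u ∷ u * v ∷ u ∷ v ∷ 1 ∷ [])) ≡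
                             sumJ₂²-p² u * sumJ₂²-q v
    sum-of-squares = solve 2 (λ u v → let P = con 1 :+ u ; sq = λ x → x :* x in
      sq (P :* u :* v) :+ (sq (P :* u) :+ (sq (u :* v) :+ (sq u :+ (sq v :+ (sq (con 1) :+ con 0)))))
        := (con 1 :+ u :* u :+ P :* u :* (P :* u)) :* (con 1 :+ v :* v)) refl

  -- P² ≤ 3 u² (as u ≥ 2) and Q² ≤ 2 (1 + v²) give (P² Q)² ≤ 6 (P u)² (1 + v²), and (P u)² < sumJ₂²-p² u.
  [P²Q]²<6·sumJ₂² : ∀ {u v} → 2 ≤ u → 1 ≤ v → P²Q u v * P²Q u v < 6 * (sumJ₂²-p² u * sumJ₂²-q v)
  [P²Q]²<6·sumJ₂² {u} {v} 2≤u 1≤v = begin-strict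
    P * P * Q * (P * P * Q)                   ≡⟨ regroup P Q ⟩
    P * P * (P * P) * (Q * Q)                 ≤⟨ *-mono-≤ (*-monoʳ-≤ (P * P) (P²≤3u² 2≤u)) (Q²≤2[1+v²] 1≤v) ⟩
    P * P * (3 * (u * u)) * (2 * sumJ₂²-q v)  ≡⟨ collect P u (sumJ₂²-q v) ⟩
    6 * (P * u * (P * u) * sumJ₂²-q v)        <⟨ *-monoʳ-< 6 (*-monoˡ-< (sumJ₂²-q v) (s≤s (m≤n+m (P * u * (P * u)) (u * u)))) ⟩
    6 * (sumJ₂²-p² u * sumJ₂²-q v)            ∎
    where
    open ≤-Reasoning
    P Q : ℕ
    P = suc u
    Q = suc v
    regroup : ∀ P Q → P * P * Q * (P * P * Q) ≡ P * P * (P * P) * (Q * Q)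
    regroup = solve-∀
    collect : ∀ P u w → P * P * (3 * (u * u)) * (2 * w) ≡ 6 * (P * u * (P * u) * w)
    collect = solve-∀
    P²≤3u² : ∀ {u} → 2 ≤ u → suc u * suc u ≤ 3 * (u * u)
    P²≤3u² {suc (suc w)} (s≤s (s≤s z≤n)) = subst ([3+w]² ≤_) (sym (identity w)) (m≤m+n [3+w]² _)
      where
      [3+w]² : ℕ
      [3+w]² = suc (suc (suc w)) * suc (suc (suc w))
      identity : ∀ w → 3 * (suc (suc w) * suc (suc w)) ≡ suc (suc (suc w)) * suc (suc (suc w)) + (3 + 6 * w + 2 * (w * w))
      identity = solve-∀
    Q²≤2[1+v²] : ∀ {v} → 1 ≤ v → suc v * suc v ≤ 2 * sumJ₂²-q v
    Q²≤2[1+v²] {suc t} (s≤s z≤n) = subst ([2+t]² ≤_) (sym (identity t)) (m≤m+n [2+t]² (t * t))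
      where
      [2+t]² : ℕ
      [2+t]² = suc (suc t) * suc (suc t)
      identity : ∀ t → 2 * (1 + suc t * suc t) ≡ suc (suc t) * suc (suc t) + t * t
      identity = solve-∀

  [E+Φ]E<Φ[E+6] : ∀ E Φ → E * E < 6 * Φ → (E + Φ) * E < Φ * (E + 6)
  [E+Φ]E<Φ[E+6] E Φ E²<6Φ = subst₂ _<_ (sym (left E Φ)) (right E Φ) (+-monoˡ-< (Φ * E) E²<6Φ)
    where
    left : ∀ E Φ → (E + Φ) * E ≡ E * E + Φ * E
    left = solve-∀
    right : ∀ E Φ → 6 * Φ + Φ * E ≡ Φ * (E + 6)
    right = solve-∀

module CyclicOfOrderP²Q (G : FinGroup) (cyclic : IsCyclic G) {p q} (p-prime : Prime p) (q-prime : Prime q) (p≢q : p ≢ q)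
                        (order≡p²q : FinGroup.order G ≡ p ℕ.^ 2 ℕ.* q) where
  open import Data.Nat.Base using (ℕ; suc; pred; _+_; _*_; _^_; _∸_; _≤_; _<_; z≤n; s≤s; NonZero; nonTrivial⇒n>1)
  open import Data.Nat.Primality using (prime⇒nonZero; prime⇒nonTrivial)
  open import Data.Nat.Properties using (*-identityʳ; *-mono-≤; m*n≢0; pred-mono-≤; suc-pred; ≤-trans)
  open import Data.Nat.Tactic.RingSolver using (solve-∀)
  open import Relation.Binary.PropositionalEquality
  open ListSums
  open SGBGraph
  open P²QArithmetic
  open FinGroup G using (order)
  open CyclicOfOrderPᵃQᵇ G cyclic p-prime q-prime p≢q {2} {1} (trans order≡p²q (cong (p ^ 2 *_) (sym (*-identityʳ q))))

  private instance
    p≢0 : NonZero p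
    p≢0 = prime⇒nonZero p-prime
    q≢0 : NonZero q
    q≢0 = prime⇒nonZero q-prime
    p*p≢0 : NonZero (p * p)
    p*p≢0 = m*n≢0 p p
    q*q≢0 : NonZero (q * q)
    q*q≢0 = m*n≢0 q q

  u v : ℕ
  u = pred (p * p)
  v = pred (q * q)

  p*p≡1+u : p * p ≡ suc u
  p*p≡1+u = sym (suc-pred (p * p))

  q*q≡1+v : q * q ≡ suc v
  q*q≡1+v = sym (suc-pred (q * q))

  2≤u : 2 ≤ u
  2≤u = ≤-trans (s≤s (s≤s z≤n)) (pred-mono-≤ (*-mono-≤ p≥2 p≥2))
    where
    p≥2 : 2 ≤ p
    p≥2 = nonTrivial⇒n>1 p {{prime⇒nonTrivial p-prime}}

  1≤v : 1 ≤ v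
  1≤v = ≤-trans (s≤s z≤n) (pred-mono-≤ (*-mono-≤ q≥2 q≥2))
    where
    q≥2 : 2 ≤ q
    q≥2 = nonTrivial⇒n>1 q {{prime⇒nonTrivial q-prime}}

  order*order≡P²Q : order * order ≡ P²Q u v
  order*order≡P²Q = trans (cong (λ n → n * n) (trans order≡p²q (cong (λ p² → p² * q) (cong (p *_) (*-identityʳ p)))))
                          (trans (regroup p q) (cong₂ (λ P Q → P * P * Q) p*p≡1+u q*q≡1+v))
    where
    regroup : ∀ p q → p * p * q * (p * p * q) ≡ p * p * (p * p) * (q * q)
    regroup = solve-∀

  ∑-degSub²≡ : ∑ (subgroups G) (λ H → degSub G H * degSub G H) ≡ sumJ₂²-p² u * sumJ₂²-q v
  ∑-degSub²≡ = trans ∑-degSub² (p²q-system⇒∑c² degree u v λ {i} {j} e∈ →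
    trans (degree-system e∈) (cong₂ (λ P Q → P ^ (2 ∸ i) * Q ^ (1 ∸ j)) p*p≡1+u q*q≡1+v))

  M₂≡ : M₂ G ≡ sumJ₂²-p² u * sumJ₂²-q v
  M₂≡ = trans (M₂≡∑degSub² G) ∑-degSub²≡

  M₁≡ : M₁ G ≡ P²Q u v + sumJ₂²-p² u * sumJ₂²-q v
  M₁≡ = trans (M₁≡order²+∑degSub² G) (cong₂ _+_ order*order≡P²Q ∑-degSub²≡)

  M₁·|E|<M₂·|V| : M₁ G * numEdges G < M₂ G * numVertices G
  M₁·|E|<M₂·|V| = subst₂ _<_ (sym (cong₂ _*_ M₁≡ (trans (numEdges≡order² G) order*order≡P²Q)))
                              (sym (cong₂ _*_ M₂≡ (trans (numVertices≡order²+|L| G) (cong₂ _+_ order*order≡P²Q length-subgroups≡))))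
                              ([E+Φ]E<Φ[E+6] (P²Q u v) _ ([P²Q]²<6·sumJ₂² 2≤u 1≤v))

open import Data.Nat using (ℕ; _<_)
open import Data.Integer using (ℤ; +_; _+_; _-_; _*_; _^_)
open import Data.Product using (_×_; _,_)
open import Data.Integer.Base using (1ℤ)
open import Data.Integer.Properties using (pos-*)
open import Data.Integer.Solver using (module +-*-Solver)
open import Data.Integer.Tactic.RingSolver using (solve-∀)
open import Relation.Binary.PropositionalEquality using (refl; sym; trans; cong; cong₂)
open P²QArithmetic using (sumJ₂²-p²; sumJ₂²-q; P²Q)

sumJ₂²-p²ℤ : ℤ → ℤ
sumJ₂²-p²ℤ U = 1ℤ + U * U + (1ℤ + U) * U * ((1ℤ + U) * U)

sumJ₂²-qℤ : ℤ → ℤ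
sumJ₂²-qℤ V = 1ℤ + V * V

P²Qℤ : ℤ → ℤ → ℤ
P²Qℤ U V = (1ℤ + U) * (1ℤ + U) * (1ℤ + V)

+u≡+m*+m-1 : ∀ {m u} → m ℕ.* m ≡ ℕ.suc u → + u ≡ + m * + m - 1ℤ
+u≡+m*+m-1 {m} {u} m*m≡1+u = trans (cancel (+ u)) (cong (_- 1ℤ) (trans (cong +_ (sym m*m≡1+u)) (pos-* m m)))
  where
  cancel : ∀ U → U ≡ 1ℤ + U - 1ℤ
  cancel = solve-∀

module _ {p q u v} (p*p≡1+u : p ℕ.* p ≡ ℕ.suc u) (q*q≡1+v : q ℕ.* q ≡ ℕ.suc v) where

  pos-sumJ₂² : + (sumJ₂²-p² u ℕ.* sumJ₂²-q v) ≡ sumJ₂²-p²ℤ (+ p * + p - 1ℤ) * sumJ₂²-qℤ (+ q * + q - 1ℤ)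
  pos-sumJ₂² = trans (pos-* (sumJ₂²-p² u) (sumJ₂²-q v)) (cong₂ _*_
    (trans (cong₂ (λ x y → 1ℤ + x + y) (pos-* u u) (trans (pos-* (ℕ.suc u ℕ.* u) _) (cong₂ _*_ (pos-* (ℕ.suc u) u) (pos-* (ℕ.suc u) u))))
           (cong sumJ₂²-p²ℤ (+u≡+m*+m-1 {p} p*p≡1+u)))
    (trans (cong (λ x → 1ℤ + x) (pos-* v v)) (cong sumJ₂²-qℤ (+u≡+m*+m-1 {q} q*q≡1+v))))

  pos-P²Q : + P²Q u v ≡ P²Qℤ (+ p * + p - 1ℤ) (+ q * + q - 1ℤ)
  pos-P²Q = trans (pos-* (ℕ.suc u ℕ.* ℕ.suc u) (ℕ.suc v)) (trans (cong (_* + ℕ.suc v) (pos-* (ℕ.suc u) (ℕ.suc u)))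
                  (cong₂ P²Qℤ (+u≡+m*+m-1 {p} p*p≡1+u) (+u≡+m*+m-1 {q} q*q≡1+v)))

M₂-polynomial : ∀ x y → sumJ₂²-p²ℤ (x * x - 1ℤ) * sumJ₂²-qℤ (y * y - 1ℤ) ≡
  x ^ 8 * y ^ 4 + + 2 * x ^ 4 * y ^ 4 + + 4 * x ^ 6 * y ^ 2
    - + 2 * x ^ 6 * y ^ 4 + + 2 * x ^ 8 + + 4 * x ^ 4 - + 2 * x ^ 8 * y ^ 2
    - + 4 * x ^ 4 * y ^ 2 - + 4 * x ^ 6 - + 2 * x ^ 2 * y ^ 4
    + + 4 * x ^ 2 * y ^ 2 + + 2 * y ^ 4 - + 4 * x ^ 2 - + 4 * y ^ 2 + + 4
M₂-polynomial = solve 2 (λ x y → let U = x :* x :- con 1ℤ ; V = y :* y :- con 1ℤ in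
    (con 1ℤ :+ U :* U :+ (con 1ℤ :+ U) :* U :* ((con 1ℤ :+ U) :* U)) :* (con 1ℤ :+ V :* V)
  := x :^ 8 :* y :^ 4 :+ con (+ 2) :* x :^ 4 :* y :^ 4 :+ con (+ 4) :* x :^ 6 :* y :^ 2
    :- con (+ 2) :* x :^ 6 :* y :^ 4 :+ con (+ 2) :* x :^ 8 :+ con (+ 4) :* x :^ 4 :- con (+ 2) :* x :^ 8 :* y :^ 2
    :- con (+ 4) :* x :^ 4 :* y :^ 2 :- con (+ 4) :* x :^ 6 :- con (+ 2) :* x :^ 2 :* y :^ 4
    :+ con (+ 4) :* x :^ 2 :* y :^ 2 :+ con (+ 2) :* y :^ 4 :- con (+ 4) :* x :^ 2 :- con (+ 4) :* y :^ 2 :+ con (+ 4)) refl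
  where open +-*-Solver

M₁-polynomial : ∀ x y → P²Qℤ (x * x - 1ℤ) (y * y - 1ℤ) + sumJ₂²-p²ℤ (x * x - 1ℤ) * sumJ₂²-qℤ (y * y - 1ℤ) ≡
  x ^ 8 * y ^ 4 + + 2 * x ^ 4 * y ^ 4 + + 4 * x ^ 6 * y ^ 2
    - + 2 * x ^ 6 * y ^ 4 + + 2 * x ^ 8 + + 4 * x ^ 4 - + 2 * x ^ 8 * y ^ 2
    - + 3 * x ^ 4 * y ^ 2 - + 4 * x ^ 6 - + 2 * x ^ 2 * y ^ 4
    + + 4 * x ^ 2 * y ^ 2 + + 2 * y ^ 4 - + 4 * x ^ 2 - + 4 * y ^ 2 + + 4
M₁-polynomial = solve 2 (λ x y → let U = x :* x :- con 1ℤ ; V = y :* y :- con 1ℤ in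
    (con 1ℤ :+ U) :* (con 1ℤ :+ U) :* (con 1ℤ :+ V)
      :+ (con 1ℤ :+ U :* U :+ (con 1ℤ :+ U) :* U :* ((con 1ℤ :+ U) :* U)) :* (con 1ℤ :+ V :* V)
  := x :^ 8 :* y :^ 4 :+ con (+ 2) :* x :^ 4 :* y :^ 4 :+ con (+ 4) :* x :^ 6 :* y :^ 2
    :- con (+ 2) :* x :^ 6 :* y :^ 4 :+ con (+ 2) :* x :^ 8 :+ con (+ 4) :* x :^ 4 :- con (+ 2) :* x :^ 8 :* y :^ 2
    :- con (+ 3) :* x :^ 4 :* y :^ 2 :- con (+ 4) :* x :^ 6 :- con (+ 2) :* x :^ 2 :* y :^ 4
    :+ con (+ 4) :* x :^ 2 :* y :^ 2 :+ con (+ 2) :* y :^ 4 :- con (+ 4) :* x :^ 2 :- con (+ 4) :* y :^ 2 :+ con (+ 4)) refl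
  where open +-*-Solver

mainTheorem5 : (p q : ℕ) → Prime p → Prime q → p ≢ q →
    (G : FinGroup) → FinGroup.order G ≡ p Data.Nat.^ 2 Data.Nat.* q → IsCyclic G →
    ((+ M₁ G) ≡ (+ p) ^ 8 * (+ q) ^ 4 + + 2 * (+ p) ^ 4 * (+ q) ^ 4 + + 4 * (+ p) ^ 6 * (+ q) ^ 2
        - + 2 * (+ p) ^ 6 * (+ q) ^ 4 + + 2 * (+ p) ^ 8 + + 4 * (+ p) ^ 4 - + 2 * (+ p) ^ 8 * (+ q) ^ 2
        - + 3 * (+ p) ^ 4 * (+ q) ^ 2 - + 4 * (+ p) ^ 6 - + 2 * (+ p) ^ 2 * (+ q) ^ 4
        + + 4 * (+ p) ^ 2 * (+ q) ^ 2 + + 2 * (+ q) ^ 4 - + 4 * (+ p) ^ 2 - + 4 * (+ q) ^ 2 + + 4)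
    × ((+ M₂ G) ≡ (+ p) ^ 8 * (+ q) ^ 4 + + 2 * (+ p) ^ 4 * (+ q) ^ 4 + + 4 * (+ p) ^ 6 * (+ q) ^ 2
        - + 2 * (+ p) ^ 6 * (+ q) ^ 4 + + 2 * (+ p) ^ 8 + + 4 * (+ p) ^ 4 - + 2 * (+ p) ^ 8 * (+ q) ^ 2
        - + 4 * (+ p) ^ 4 * (+ q) ^ 2 - + 4 * (+ p) ^ 6 - + 2 * (+ p) ^ 2 * (+ q) ^ 4
        + + 4 * (+ p) ^ 2 * (+ q) ^ 2 + + 2 * (+ q) ^ 4 - + 4 * (+ p) ^ 2 - + 4 * (+ q) ^ 2 + + 4)
    × (M₁ G Data.Nat.* numEdges G < M₂ G Data.Nat.* numVertices G)
mainTheorem5 p q p-prime q-prime p≢q G order≡p²q cyclic =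
    trans (cong +_ M₁≡) (trans (cong₂ _+_ (pos-P²Q {p} {q} p*p≡1+u q*q≡1+v) (pos-sumJ₂² {p} {q} p*p≡1+u q*q≡1+v)) (M₁-polynomial (+ p) (+ q)))
  , trans (cong +_ M₂≡) (trans (pos-sumJ₂² {p} {q} p*p≡1+u q*q≡1+v) (M₂-polynomial (+ p) (+ q)))
  , M₁·|E|<M₂·|V|
  where open CyclicOfOrderP²Q G cyclic p-prime q-prime p≢q order≡p²q
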